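{- Let $n\ge 2$, $T\subseteq\{1,\dots,n-1\}$, $1\le i,j\le n$, and let $\mathcal{F}$ be an independent set of $\Gamma(n,T)$. Then $S_{i,j}(\mathcal{F})$ is also an independent set of $\Gamma(n,T)$ and $|S_{i,j}(\mathcal{F})|=|\mathcal{F}|$.
   Context: $[n]=\{1,\dots,n\}$. Two subsets $X,Y\subseteq[n]$ are opposite if $X\cap Y=\emptyset$ or $X\cup Y=[n]$. A flag of $[n]$ of type $T$ is a chain (w.r.t. inclusion) of non-empty proper subsets of $[n]$ whose set of cardinalities is $T$; it is written as a tuple $f=(F_1,\dots,F_t)$ with $|T|=t$. Two flags are opposite if every member of one is opposite to every member of the other. $\Gamma(n,T)$ is the graph whose vertices are the flags of type $T$, adjacent iff opposite; an independent set is a set of pairwise non-adjacent vertices. For $A\subseteq[n]$, $S_{i,j}(A)=(A\setminus\{i\})\cup\{j\}$ if $i\in A$ and $j\notin A$, and $S_{i,j}(A)=A$ otherwise; $S_{i,j}(f)=(S_{i,j}(F_1),\dots,S_{i,j}(F_t))$. For a set $\mathcal{F}$ of flags and $f\in\mathcal{F}$, put $S^{\mathcal{F}}_{i,j}(f)=S_{i,j}(f)$ if $S_{i,j}(f)\notin\mathcal{F}$ and $S^{\mathcal{F}}_{i,j}(f)=f$ otherwise, and $S_{i,j}(\mathcal{F})=\{S^{\mathcal{F}}_{i,j}(f): f\in\mathcal{F}\}$. -}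

module Defs where

open import Data.Bool using (Bool; true; false; if_then_else_)
import Data.Bool.Properties as BoolP
open import Data.Nat using (ℕ; _<_; _≤_)
open import Data.Fin using (Fin)
open import Data.Fin.Subset using (Subset; ⊥; ⊤; _∩_; _∪_; _⊆_; ∣_∣)
open import Data.Vec using (lookup; _[_]≔_)
import Data.Vec.Properties as VecP
open import Data.List using (List; map; length)
import Data.List.Properties as ListP
open import Data.List.Relation.Unary.All using (All)
open import Data.List.Relation.Unary.Linked using (Linked)
open import Data.List.Relation.Unary.Unique.Propositional using (Unique)
open import Data.List.Membership.Propositional using (_∈_)
import Data.List.Membership.DecPropositional as DecMem
open import Data.Product using (_×_)
open import Data.Sum using (_⊎_)
open import Relation.Binary.PropositionalEquality using (_≡_; _≢_)
open import Relation.Binary.Definitions using (DecidableEquality)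
open import Relation.Nullary using (¬_; yes; no)

-- Elements of [n] = {1,…,n} are represented by Fin n (element k+1 ↦ k);
-- subsets of [n] by Data.Fin.Subset.Subset n.

Opposite : ∀ {n} → Subset n → Subset n → Set
Opposite X Y = (X ∩ Y ≡ ⊥) ⊎ (X ∪ Y ≡ ⊤)

Flag : ℕ → Set
Flag n = List (Subset n)

IsType : ℕ → List ℕ → Set
IsType n T = Linked _<_ T × All (λ t → 1 ≤ t × t < n) T

IsFlag : (n : ℕ) → List ℕ → Flag n → Set
IsFlag n T f =
  All (λ X → X ≢ ⊥ × X ≢ ⊤) f × Linked _⊆_ f × map ∣_∣ f ≡ T

OppositeFlags : ∀ {n} → Flag n → Flag n → Set
OppositeFlags f g = All (λ X → All (λ Y → Opposite X Y) g) f

IsFlagSet : (n : ℕ) → List ℕ → List (Flag n) → Set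
IsFlagSet n T 𝓕 = Unique 𝓕 × All (IsFlag n T) 𝓕

IsIndependent : (n : ℕ) → List ℕ → List (Flag n) → Set
IsIndependent n T 𝓕 =
  IsFlagSet n T 𝓕 ×
  (∀ {f g} → f ∈ 𝓕 → g ∈ 𝓕 → f ≢ g → ¬ OppositeFlags f g)

shift : ∀ {n} → Fin n → Fin n → Subset n → Subset n
shift i j A with lookup A i | lookup A j
... | true | false = (A [ i ]≔ false) [ j ]≔ true
... | _    | _     = A

shiftFlag : ∀ {n} → Fin n → Fin n → Flag n → Flag n
shiftFlag i j f = map (shift i j) f

_≟F_ : ∀ {n} → DecidableEquality (Flag n)
_≟F_ = ListP.≡-dec (VecP.≡-dec BoolP._≟_)

shiftIn : ∀ {n} → Fin n → Fin n → List (Flag n) → Flag n → Flag n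
shiftIn i j 𝓕 f with DecMem._∈?_ _≟F_ (shiftFlag i j f) 𝓕
... | yes _ = f
... | no  _ = shiftFlag i j f

shiftFamily : ∀ {n} → Fin n → Fin n → List (Flag n) → List (Flag n)
shiftFamily i j 𝓕 = map (shiftIn i j 𝓕) 𝓕

-- The shift S = S_{i,j} changes a subset only in the coordinates i and j, where it sorts the
-- pair (X_i , X_j) into (X_i ∧ X_j , X_i ∨ X_j). Disjointness, covering, inclusion and equality
-- are coordinatewise, so each needed property of S reduces to a fact about pairs of Booleans:
-- S preserves cardinality and inclusion, hence flags of type T; S X ⟂ S Y implies X ⟂ Y
-- (⟂ meaning opposite); and when (Y_i , Y_j) ≠ (0 , 1), X ⟂ S Y implies S X ⟂ Y and S is
-- injective on such Y. A flag moved by S has a member X with i ∈ X, j ∉ X, so, being a chain,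
-- none of its members has (Y_i , Y_j) = (0 , 1). Distinguishing whether S^𝓕 keeps or moves
-- each of two flags of 𝓕 then gives injectivity of S^𝓕 on 𝓕 and independence of the image.

module Submission where

open import Defs
open import Level using (Level; 0ℓ)
open import Function using (_∘_; _⇔_; mk⇔; Equivalence)
open import Data.Bool using (Bool; true; false; _∧_; _∨_; b≤b; f≤t) renaming (_≤_ to _≤ᵇ_)
open import Data.Bool.Properties
  using (∧-zeroʳ; ∨-zeroʳ; ≤-minimum; ≤-maximum) renaming (_≟_ to _≟ᵇ_)
open import Data.Empty using (⊥-elim)
open import Data.Fin using (Fin; zero; suc)
open import Data.Fin.Properties using (_≟_)
open import Data.Fin.Subset using (Subset; ⊥; ⊤; _⊆_; ∣_∣; _-_)
open import Data.Fin.Subset.Properties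
  using (Empty-unique; x∈p⇒∣p-x∣<∣p∣; ∣p∣≡n⇒p≡⊤; ∣⊥∣≡0; ∣⊤∣≡n; ⊆-refl; ⊆-trans; ∩-comm; ∪-comm)
open import Data.List using (List; []; _∷_; map; length)
open import Data.List.Properties
  using (∷-injectiveˡ; ∷-injectiveʳ; map-∘; map-cong; map-id-local; length-map)
open import Data.List.Relation.Unary.All using (All; []; _∷_)
import Data.List.Relation.Unary.All as All
import Data.List.Relation.Unary.All.Properties as All
open import Data.List.Relation.Unary.Any using (here; there; any?)
open import Data.List.Relation.Unary.AllPairs using (AllPairs; []; _∷_)
open import Data.List.Relation.Unary.Linked using (Linked)
import Data.List.Relation.Unary.Linked as Linked
import Data.List.Relation.Unary.Linked.Properties as Linked
open import Data.List.Relation.Unary.Unique.Propositional using (Unique)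
open import Data.List.Membership.Propositional using (_∈_; _∉_; find)
open import Data.List.Membership.Propositional.Properties using (∈-map⁻)
open import Data.Nat using (ℕ; suc; _<_; _≤_)
open import Data.Nat.Properties using (n≮0)
open import Data.Product using (_×_; _,_; proj₁; proj₂; swap)
import Data.Product as Product
open import Data.Product.Properties using () renaming (≡-dec to ×-≡-dec)
open import Data.Product.Relation.Binary.Pointwise.NonDependent
  using (≡×≡⇒≡; ≡⇒≡×≡) renaming (Pointwise to ×-Pointwise)
open import Data.Sum using (_⊎_; inj₁; inj₂)
import Data.Sum as Sum
open import Data.Sum.Function.Propositional using (_⊎-⇔_)
open import Data.Vec using (Vec; _∷_; lookup; _[_]≔_; zipWith; replicate)
open import Data.Vec.Properties
  using (lookup-zipWith; lookup-replicate; lookup∘update; lookup∘update′; []≔-lookup; []=⇒lookup; lookup⇒[]=)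
open import Data.Vec.Relation.Binary.Pointwise.Extensional
  using (Pointwise; ext; Pointwise-≡⇒≡; ≡⇒Pointwise-≡)
import Data.List.Membership.DecPropositional as DecMem
open import Relation.Binary using (Rel; Reflexive)
open import Relation.Binary.PropositionalEquality
open import Relation.Nullary using (¬_; yes; no; contradiction)

private
  variable
    a b : Level
    A : Set a
    B : Set b
    n : ℕ

allPairs-connex : ∀ {ℓ} {R : Rel A ℓ} → Reflexive R →
  ∀ {xs x y} → AllPairs R xs → x ∈ xs → y ∈ xs → R x y ⊎ R y x
allPairs-connex refl-R (_ ∷ _)   (here refl) (here refl) = inj₁ refl-R
allPairs-connex _      (Rx ∷ _)  (here refl) (there y∈)  = inj₁ (All.lookup Rx y∈)
allPairs-connex _      (Rx ∷ _)  (there x∈)  (here refl) = inj₂ (All.lookup Rx x∈)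
allPairs-connex refl-R (_ ∷ Rxs) (there x∈)  (there y∈)  = allPairs-connex refl-R Rxs x∈ y∈

map-injectiveOn : ∀ {ℓ} {P : A → Set ℓ} {f : A → B} →
  (∀ {x y} → P x → P y → f x ≡ f y → x ≡ y) →
  ∀ {xs ys} → All P xs → All P ys → map f xs ≡ map f ys → xs ≡ ys
map-injectiveOn inj []         []         _  = refl
map-injectiveOn inj (px ∷ pxs) (py ∷ pys) eq =
  cong₂ _∷_ (inj px py (∷-injectiveˡ eq)) (map-injectiveOn inj pxs pys (∷-injectiveʳ eq))

unique-map⁺ : ∀ {f : A → B} {xs} →
  (∀ {x y} → x ∈ xs → y ∈ xs → f x ≡ f y → x ≡ y) → Unique xs → Unique (map f xs)
unique-map⁺ {xs = []}     _   []          = []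
unique-map⁺ {xs = x ∷ xs} inj (x∉xs ∷ u) =
  All.map⁺ (All.tabulate λ y∈ fx≡fy → All.lookup x∉xs y∈ (inj (here refl) (there y∈) fx≡fy))
  ∷ unique-map⁺ (λ x∈ y∈ → inj (there x∈) (there y∈)) u

sort : Bool × Bool → Bool × Bool
sort (a , b) = a ∧ b , a ∨ b

Both : Rel Bool 0ℓ → Rel (Bool × Bool) 0ℓ
Both R = ×-Pointwise R R

Disjointᵇ Coveringᵇ : Rel Bool 0ℓ
Disjointᵇ a b = a ∧ b ≡ false
Coveringᵇ a b = a ∨ b ≡ true

sort-fixes : ∀ p → p ≢ (true , false) → sort p ≡ p
sort-fixes (true  , true)  _  = refl
sort-fixes (true  , false) ne = ⊥-elim (ne refl)
sort-fixes (false , _)     _  = refl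

sort≢true,false : ∀ p → sort p ≢ (true , false)
sort≢true,false (true  , _) ()
sort≢true,false (false , _) ()

sort≡swap : ∀ p → p ≢ (false , true) → sort p ≡ swap p
sort≡swap (true  , true)  _  = refl
sort≡swap (true  , false) _  = refl
sort≡swap (false , true)  ne = ⊥-elim (ne refl)
sort≡swap (false , false) _  = refl

sort-injectiveOn : ∀ {p q} → p ≢ (false , true) → q ≢ (false , true) →
  Both _≡_ (sort p) (sort q) → Both _≡_ p q
sort-injectiveOn {p} {q} p≢ q≢ e = ≡⇒≡×≡ (cong swap (begin
  swap p ≡⟨ sort≡swap p p≢ ⟨
  sort p ≡⟨ ≡×≡⇒≡ e ⟩
  sort q ≡⟨ sort≡swap q q≢ ⟩
  swap q ∎))
  where open ≡-Reasoning

sort-monotone : ∀ {p q} → Both _≤ᵇ_ p q → Both _≤ᵇ_ (sort p) (sort q)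
sort-monotone                 (b≤b , b≤b) = b≤b , b≤b
sort-monotone {p = _ , b}     (f≤t , b≤b) = ≤-minimum b , ≤-maximum b
sort-monotone {p = true , _}  (b≤b , f≤t) = f≤t , b≤b
sort-monotone {p = false , _} (b≤b , f≤t) = b≤b , f≤t
sort-monotone                 (f≤t , f≤t) = f≤t , f≤t

disjoint-unsort : ∀ p q → Both Disjointᵇ (sort p) (sort q) → Both Disjointᵇ p q
disjoint-unsort (false , false) _               _       = refl , refl
disjoint-unsort (a     , b)     (false , false) _       = ∧-zeroʳ a , ∧-zeroʳ b
disjoint-unsort (true  , _)     (true  , _)     (_ , ())
disjoint-unsort (true  , _)     (false , true)  (_ , ())
disjoint-unsort (false , true)  (true  , _)     (_ , ())
disjoint-unsort (false , true)  (false , true)  (_ , ())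

covering-unsort : ∀ p q → Both Coveringᵇ (sort p) (sort q) → Both Coveringᵇ p q
covering-unsort (true  , true)  _              _       = refl , refl
covering-unsort (a     , b)     (true  , true) _       = ∨-zeroʳ a , ∨-zeroʳ b
covering-unsort (false , _)     (false , _)    (() , _)
covering-unsort (false , _)     (true , false) (() , _)
covering-unsort (true , false)  (false , _)    (() , _)
covering-unsort (true , false)  (true , false) (() , _)

disjoint-sortʳ⇒sortˡ : ∀ p q → q ≢ (false , true) →
  Both Disjointᵇ p (sort q) → Both Disjointᵇ (sort p) q
disjoint-sortʳ⇒sortˡ _               (false , true)  q≢ _       = ⊥-elim (q≢ refl)
disjoint-sortʳ⇒sortˡ (a , b)         (false , false) _  _       = ∧-zeroʳ (a ∧ b) , ∧-zeroʳ (a ∨ b)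
disjoint-sortʳ⇒sortˡ (false , false) (true , true)   _  _       = refl , refl
disjoint-sortʳ⇒sortˡ (true , _)      (true , true)   _  (() , _)
disjoint-sortʳ⇒sortˡ (false , true)  (true , true)   _  (_ , ())
disjoint-sortʳ⇒sortˡ (_ , true)      (true , false)  _  (_ , ())
disjoint-sortʳ⇒sortˡ (false , false) (true , false)  _  _       = refl , refl
disjoint-sortʳ⇒sortˡ (true , false)  (true , false)  _  _       = refl , refl

covering-sortʳ⇒sortˡ : ∀ p q → q ≢ (false , true) →
  Both Coveringᵇ p (sort q) → Both Coveringᵇ (sort p) q
covering-sortʳ⇒sortˡ _               (false , true)  q≢ _       = ⊥-elim (q≢ refl)
covering-sortʳ⇒sortˡ (a , b)         (true , true)   _  _       = ∨-zeroʳ (a ∧ b) , ∨-zeroʳ (a ∨ b)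
covering-sortʳ⇒sortˡ (true , true)   (false , false) _  _       = refl , refl
covering-sortʳ⇒sortˡ (false , _)     (false , false) _  (() , _)
covering-sortʳ⇒sortˡ (true , false)  (false , false) _  (_ , ())
covering-sortʳ⇒sortˡ (true , b)      (true , false)  _  _       = ∨-zeroʳ b , refl
covering-sortʳ⇒sortˡ (false , _)     (true , false)  _  (() , _)

zipWith≡replicate⇔ : ∀ {c} {C : Set c} (f : A → B → C) z {xs : Vec A n} {ys : Vec B n} →
  zipWith f xs ys ≡ replicate n z ⇔ Pointwise (λ x y → f x y ≡ z) xs ys
zipWith≡replicate⇔ f z {xs} {ys} = mk⇔
  (λ eq → ext λ k → begin
    f (lookup xs k) (lookup ys k) ≡⟨ lookup-zipWith f k xs ys ⟨
    lookup (zipWith f xs ys) k    ≡⟨ cong (λ v → lookup v k) eq ⟩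
    lookup (replicate _ z) k      ≡⟨ lookup-replicate k z ⟩
    z                             ∎)
  (λ (ext fk≡z) → Pointwise-≡⇒≡ (ext λ k →
    trans (lookup-zipWith f k xs ys) (trans (fk≡z k) (sym (lookup-replicate k z)))))
  where open ≡-Reasoning

Opposite⇔ : {X Y : Subset n} →
  Opposite X Y ⇔ (Pointwise Disjointᵇ X Y ⊎ Pointwise Coveringᵇ X Y)
Opposite⇔ = zipWith≡replicate⇔ _∧_ false ⊎-⇔ zipWith≡replicate⇔ _∨_ true

opposite-sym : {X Y : Subset n} → Opposite X Y → Opposite Y X
opposite-sym {X = X} {Y} = Sum.map (trans (∩-comm Y X)) (trans (∪-comm Y X))

oppositeFlags-sym : {f g : Flag n} → OppositeFlags f g → OppositeFlags g f
oppositeFlags-sym o =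
  All.tabulate λ Y∈ → All.tabulate λ X∈ → opposite-sym (All.lookup (All.lookup o X∈) Y∈)

true≤⇒≡true : ∀ {b} → true ≤ᵇ b → b ≡ true
true≤⇒≡true b≤b = refl

⊆⇔Pointwise≤ : {X Y : Subset n} → X ⊆ Y ⇔ Pointwise _≤ᵇ_ X Y
⊆⇔Pointwise≤ {X = X} {Y} = mk⇔
  (λ (X⊆Y : X ⊆ Y) → ext (lookup≤ X⊆Y))
  (λ (ext X≤Y) {k} k∈X →
    lookup⇒[]= k Y (true≤⇒≡true (subst (_≤ᵇ lookup Y k) ([]=⇒lookup k∈X) (X≤Y k))))
  where
  lookup≤ : X ⊆ Y → ∀ k → lookup X k ≤ᵇ lookup Y k
  lookup≤ X⊆Y k with lookup X k in eq
  ... | false = ≤-minimum _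
  ... | true  = subst (true ≤ᵇ_) (sym ([]=⇒lookup (X⊆Y (lookup⇒[]= k X eq)))) b≤b

∣p[x]≔true∣≡suc∣p[x]≔false∣ : ∀ (p : Subset n) x → ∣ p [ x ]≔ true ∣ ≡ suc ∣ p [ x ]≔ false ∣
∣p[x]≔true∣≡suc∣p[x]≔false∣ (_     ∷ p) zero    = refl
∣p[x]≔true∣≡suc∣p[x]≔false∣ (true  ∷ p) (suc x) = cong suc (∣p[x]≔true∣≡suc∣p[x]≔false∣ p x)
∣p[x]≔true∣≡suc∣p[x]≔false∣ (false ∷ p) (suc x) = ∣p[x]≔true∣≡suc∣p[x]≔false∣ p x

∣p∣≡0⇒p≡⊥ : {p : Subset n} → ∣ p ∣ ≡ 0 → p ≡ ⊥
∣p∣≡0⇒p≡⊥ {p = p} ∣p∣≡0 =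
  Empty-unique λ (x , x∈p) → n≮0 (subst (∣ p - x ∣ <_) ∣p∣≡0 (x∈p⇒∣p-x∣<∣p∣ x∈p))

module Shift {n : ℕ} (i j : Fin n) where

  pair : Subset n → Bool × Bool
  pair A = lookup A i , lookup A j

  -- (false , true) is the only pair with two preimages under sort.
  Unshifted : Subset n → Set
  Unshifted A = pair A ≢ (false , true)

  coordinatewise : {Q : Fin n → Set} → Q i → Q j → (∀ k → k ≢ i → k ≢ j → Q k) → ∀ k → Q k
  coordinatewise qi qj q k with k ≟ i | k ≟ j
  ... | yes refl | _        = qi
  ... | no _     | yes refl = qj
  ... | no k≢i   | no k≢j   = q k k≢i k≢j

  record PairUpdate (A B : Subset n) (p : Bool × Bool) : Set where
    field
      pair≡    : pair B ≡ p
      off-pair : ∀ k → k ≢ i → k ≢ j → lookup B k ≡ lookup A k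
  open PairUpdate

  pairUpdate-refl : ∀ {A} → PairUpdate A A (pair A)
  pairUpdate-refl = record { pair≡ = refl ; off-pair = λ _ _ _ → refl }

  movable⇒i≢j : ∀ {A} → pair A ≡ (true , false) → i ≢ j
  movable⇒i≢j A≡ refl = contradiction (trans (sym (cong proj₁ A≡)) (cong proj₂ A≡)) λ ()

  data ShiftView (A : Subset n) : Subset n → Set where
    moves : pair A ≡ (true , false) → ShiftView A ((A [ i ]≔ false) [ j ]≔ true)
    stays : pair A ≢ (true , false) → ShiftView A A

  shift-view : ∀ A → ShiftView A (shift i j A)
  shift-view A with lookup A i in Ai | lookup A j in Aj
  ... | true  | false = moves (cong₂ _,_ Ai Aj)
  ... | true  | true  = stays λ e → contradiction (trans (sym Aj) (cong proj₂ e)) λ ()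
  ... | false | _     = stays λ e → contradiction (trans (sym Ai) (cong proj₁ e)) λ ()

  shift-pairUpdate : ∀ A → PairUpdate A (shift i j A) (sort (pair A))
  shift-pairUpdate A with shift i j A | shift-view A
  ... | _ | stays A≢ = record { pair≡ = sym (sort-fixes (pair A) A≢) ; off-pair = λ _ _ _ → refl }
  ... | _ | moves A≡ = record
    { pair≡    = trans (cong₂ _,_ (trans (lookup∘update′ (movable⇒i≢j {A} A≡) (A [ i ]≔ false) true)
                                         (lookup∘update i A false))
                                  (lookup∘update j (A [ i ]≔ false) true))
                       (cong sort (sym A≡))
    ; off-pair = λ k k≢i k≢j →
        trans (lookup∘update′ k≢j (A [ i ]≔ false) true) (lookup∘update′ k≢i A false)
    }

  shift-fixes : ∀ {A} → pair A ≢ (true , false) → shift i j A ≡ A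
  shift-fixes {A} A≢ with shift i j A | shift-view A
  ... | _ | moves A≡ = ⊥-elim (A≢ A≡)
  ... | _ | stays _  = refl

  shift-idempotent : ∀ A → shift i j (shift i j A) ≡ shift i j A
  shift-idempotent A = shift-fixes λ e →
    sort≢true,false (pair A) (trans (sym (pair≡ (shift-pairUpdate A))) e)

  ∣shift∣ : ∀ A → ∣ shift i j A ∣ ≡ ∣ A ∣
  ∣shift∣ A with shift i j A | shift-view A
  ... | _ | stays _  = refl
  ... | _ | moves A≡ = begin
    ∣ A′ [ j ]≔ true ∣        ≡⟨ ∣p[x]≔true∣≡suc∣p[x]≔false∣ A′ j ⟩
    suc ∣ A′ [ j ]≔ false ∣   ≡⟨ cong (suc ∘ ∣_∣) (update-unchanged A′ j A′j≡false) ⟩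
    suc ∣ A′ ∣                ≡⟨ ∣p[x]≔true∣≡suc∣p[x]≔false∣ A i ⟨
    ∣ A [ i ]≔ true ∣         ≡⟨ cong ∣_∣ (update-unchanged A i (cong proj₁ A≡)) ⟩
    ∣ A ∣                     ∎
    where
    open ≡-Reasoning
    A′ = A [ i ]≔ false
    update-unchanged : ∀ (X : Subset n) k {b} → lookup X k ≡ b → X [ k ]≔ b ≡ X
    update-unchanged X k refl = []≔-lookup X k
    A′j≡false : lookup A′ j ≡ false
    A′j≡false = trans (lookup∘update′ (movable⇒i≢j {A} A≡ ∘ sym) A false) (cong proj₂ A≡)

  transfer : ∀ {R : Rel Bool 0ℓ} {A B X Y X′ Y′ p q p′ q′} →
    PairUpdate A X p → PairUpdate B Y q → PairUpdate A X′ p′ → PairUpdate B Y′ q′ →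
    (Both R p q → Both R p′ q′) → Pointwise R X Y → Pointwise R X′ Y′
  transfer {R} X Y X′ Y′ onPair (ext r) = ext (coordinatewise (proj₁ r′) (proj₂ r′) elsewhere)
    where
    r′ = subst₂ (Both R) (sym (pair≡ X′)) (sym (pair≡ Y′))
           (onPair (subst₂ (Both R) (pair≡ X) (pair≡ Y) (r i , r j)))
    elsewhere : ∀ k → k ≢ i → k ≢ j → R _ _
    elsewhere k k≢i k≢j = subst₂ R
      (trans (off-pair X k k≢i k≢j) (sym (off-pair X′ k k≢i k≢j)))
      (trans (off-pair Y k k≢i k≢j) (sym (off-pair Y′ k k≢i k≢j)))
      (r k)

  opposite-transfer : ∀ {A B X Y X′ Y′ p q p′ q′} →
    PairUpdate A X p → PairUpdate B Y q → PairUpdate A X′ p′ → PairUpdate B Y′ q′ →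
    (Both Disjointᵇ p q → Both Disjointᵇ p′ q′) → (Both Coveringᵇ p q → Both Coveringᵇ p′ q′) →
    Opposite X Y → Opposite X′ Y′
  opposite-transfer X Y X′ Y′ disj cov =
    Equivalence.from Opposite⇔ ∘ Sum.map (transfer X Y X′ Y′ disj) (transfer X Y X′ Y′ cov)
    ∘ Equivalence.to Opposite⇔

  opposite-unshift : ∀ {X Y} → Opposite (shift i j X) (shift i j Y) → Opposite X Y
  opposite-unshift {X} {Y} = opposite-transfer (shift-pairUpdate X) (shift-pairUpdate Y)
    pairUpdate-refl pairUpdate-refl
    (disjoint-unsort (pair X) (pair Y)) (covering-unsort (pair X) (pair Y))

  opposite-shiftʳ⇒shiftˡ : ∀ {X Y} → Unshifted Y →
    Opposite X (shift i j Y) → Opposite (shift i j X) Y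
  opposite-shiftʳ⇒shiftˡ {X} {Y} uY = opposite-transfer pairUpdate-refl (shift-pairUpdate Y)
    (shift-pairUpdate X) pairUpdate-refl
    (disjoint-sortʳ⇒sortˡ (pair X) (pair Y) uY) (covering-sortʳ⇒sortˡ (pair X) (pair Y) uY)

  shift-injectiveOn : ∀ {X Y} → Unshifted X → Unshifted Y → shift i j X ≡ shift i j Y → X ≡ Y
  shift-injectiveOn {X} {Y} uX uY = Pointwise-≡⇒≡
    ∘ transfer (shift-pairUpdate X) (shift-pairUpdate Y) pairUpdate-refl pairUpdate-refl
               (sort-injectiveOn uX uY)
    ∘ ≡⇒Pointwise-≡

  shift-monotone : ∀ {X Y} → X ⊆ Y → shift i j X ⊆ shift i j Y
  shift-monotone {X} {Y} = Equivalence.from ⊆⇔Pointwise≤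
    ∘ transfer pairUpdate-refl pairUpdate-refl (shift-pairUpdate X) (shift-pairUpdate Y)
               sort-monotone
    ∘ Equivalence.to ⊆⇔Pointwise≤

  shift≡⊥⇒≡⊥ : ∀ {X} → shift i j X ≡ ⊥ → X ≡ ⊥
  shift≡⊥⇒≡⊥ {X} e = ∣p∣≡0⇒p≡⊥ (trans (sym (∣shift∣ X)) (trans (cong ∣_∣ e) (∣⊥∣≡0 n)))

  shift≡⊤⇒≡⊤ : ∀ {X} → shift i j X ≡ ⊤ → X ≡ ⊤
  shift≡⊤⇒≡⊤ {X} e = ∣p∣≡n⇒p≡⊤ (trans (sym (∣shift∣ X)) (trans (cong ∣_∣ e) (∣⊤∣≡n n)))

  movable-comparable⇒unshifted : ∀ {X Y} → pair X ≡ (true , false) → Y ⊆ X ⊎ X ⊆ Y → Unshifted Y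
  movable-comparable⇒unshifted X≡ (inj₁ Y⊆X) Y≡ = contradiction
    (trans (sym ([]=⇒lookup (Y⊆X (lookup⇒[]= j _ (cong proj₂ Y≡))))) (cong proj₂ X≡)) λ ()
  movable-comparable⇒unshifted X≡ (inj₂ X⊆Y) Y≡ = contradiction
    (trans (sym ([]=⇒lookup (X⊆Y (lookup⇒[]= i _ (cong proj₁ X≡))))) (cong proj₁ Y≡)) λ ()

  shiftFlag-isFlag : ∀ {T f} → IsFlag n T f → IsFlag n T (shiftFlag i j f)
  shiftFlag-isFlag {T} {f} (proper , chain , ∣f∣≡T) =
    All.map⁺ (All.map (Product.map (_∘ shift≡⊥⇒≡⊥) (_∘ shift≡⊤⇒≡⊤)) proper) ,
    Linked.map⁺ (Linked.map shift-monotone chain) ,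
    (begin
      map ∣_∣ (map (shift i j) f) ≡⟨ map-∘ f ⟨
      map (∣_∣ ∘ shift i j) f     ≡⟨ map-cong ∣shift∣ f ⟩
      map ∣_∣ f                   ≡⟨ ∣f∣≡T ⟩
      T                           ∎)
    where open ≡-Reasoning

  shiftFlag-idempotent : ∀ f → shiftFlag i j (shiftFlag i j f) ≡ shiftFlag i j f
  shiftFlag-idempotent f = trans (sym (map-∘ f)) (map-cong shift-idempotent f)

  shiftFlag-injectiveOn : ∀ {f g} → All Unshifted f → All Unshifted g →
    shiftFlag i j f ≡ shiftFlag i j g → f ≡ g
  shiftFlag-injectiveOn = map-injectiveOn shift-injectiveOn

  oppositeFlags-unshift : ∀ {f g} →
    OppositeFlags (shiftFlag i j f) (shiftFlag i j g) → OppositeFlags f g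
  oppositeFlags-unshift = All.map (All.map opposite-unshift ∘ All.map⁻) ∘ All.map⁻

  oppositeFlags-shiftʳ⇒shiftˡ : ∀ {f g} → All Unshifted g →
    OppositeFlags f (shiftFlag i j g) → OppositeFlags (shiftFlag i j f) g
  oppositeFlags-shiftʳ⇒shiftˡ ug =
    All.map⁺ ∘ All.map λ o →
      All.zipWith (λ (u , o′) → opposite-shiftʳ⇒shiftˡ u o′) (ug , All.map⁻ o)

  -- A moved chain has a member X with i ∈ X, j ∉ X, and all its members are comparable with X.
  moved⇒unshifted : ∀ {f} → Linked _⊆_ f → shiftFlag i j f ≢ f → All Unshifted f
  moved⇒unshifted {f} chain Sf≢f with any? (λ X → ×-≡-dec _≟ᵇ_ _≟ᵇ_ (pair X) (true , false)) f
  ... | no none = ⊥-elim (Sf≢f (map-id-local (All.map shift-fixes (All.¬Any⇒All¬ f none))))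
  ... | yes some with find some
  ...   | X , X∈f , X≡ = All.tabulate λ Y∈f → movable-comparable⇒unshifted X≡
    (allPairs-connex {R = _⊆_} ⊆-refl (Linked.Linked⇒AllPairs ⊆-trans chain) Y∈f X∈f)

  module _ {T : List ℕ} {𝓕 : List (Flag n)} (independent : IsIndependent n T 𝓕) where

    private
      unique      = proj₁ (proj₁ independent)
      flags       = proj₂ (proj₁ independent)
      nonOpposite = proj₂ independent

    data ShiftInView (f : Flag n) : Flag n → Set where
      kept  : shiftFlag i j f ∈ 𝓕 → ShiftInView f f
      moved : shiftFlag i j f ∉ 𝓕 → ShiftInView f (shiftFlag i j f)

    shiftIn-view : ∀ f → ShiftInView f (shiftIn i j 𝓕 f)
    shiftIn-view f with DecMem._∈?_ _≟F_ (shiftFlag i j f) 𝓕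
    ... | yes s∈ = kept s∈
    ... | no  s∉ = moved s∉

    moved-member⇒unshifted : ∀ {f} → f ∈ 𝓕 → shiftFlag i j f ∉ 𝓕 → All Unshifted f
    moved-member⇒unshifted f∈ s∉ = moved⇒unshifted
      (proj₁ (proj₂ (All.lookup flags f∈))) λ e → s∉ (subst (_∈ 𝓕) (sym e) f∈)

    shiftIn-injectiveOn : ∀ {f g} → f ∈ 𝓕 → g ∈ 𝓕 → shiftIn i j 𝓕 f ≡ shiftIn i j 𝓕 g → f ≡ g
    shiftIn-injectiveOn {f} {g} f∈ g∈ e
      with shiftIn i j 𝓕 f | shiftIn-view f | shiftIn i j 𝓕 g | shiftIn-view g
    ... | _ | kept _   | _ | kept _   = e
    ... | _ | kept _   | _ | moved s∉ = ⊥-elim (s∉ (subst (_∈ 𝓕) e f∈))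
    ... | _ | moved s∉ | _ | kept _   = ⊥-elim (s∉ (subst (_∈ 𝓕) (sym e) g∈))
    ... | _ | moved f∉ | _ | moved g∉ =
      shiftFlag-injectiveOn (moved-member⇒unshifted f∈ f∉) (moved-member⇒unshifted g∈ g∉) e

    -- f ⟂ S g gives S f ⟂ g, and S f ≢ g since otherwise S g = S (S f) = S f ∈ 𝓕.
    kept-moved-nonOpposite : ∀ {f g} → f ∈ 𝓕 → g ∈ 𝓕 → shiftFlag i j f ∈ 𝓕 → shiftFlag i j g ∉ 𝓕 →
      ¬ OppositeFlags f (shiftFlag i j g)
    kept-moved-nonOpposite {f} f∈ g∈ sf∈ sg∉ o = nonOpposite sf∈ g∈
      (λ e → sg∉ (subst (_∈ 𝓕) (trans (sym (shiftFlag-idempotent f)) (cong (shiftFlag i j) e)) sf∈))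
      (oppositeFlags-shiftʳ⇒shiftˡ (moved-member⇒unshifted g∈ sg∉) o)

    shiftIn-nonOpposite : ∀ {f g} → f ∈ 𝓕 → g ∈ 𝓕 → shiftIn i j 𝓕 f ≢ shiftIn i j 𝓕 g →
      ¬ OppositeFlags (shiftIn i j 𝓕 f) (shiftIn i j 𝓕 g)
    shiftIn-nonOpposite {f} {g} f∈ g∈ ne o
      with shiftIn i j 𝓕 f | shiftIn-view f | shiftIn i j 𝓕 g | shiftIn-view g
    ... | _ | kept _    | _ | kept _    = nonOpposite f∈ g∈ ne o
    ... | _ | kept sf∈  | _ | moved sg∉ = kept-moved-nonOpposite f∈ g∈ sf∈ sg∉ o
    ... | _ | moved sf∉ | _ | kept sg∈  = kept-moved-nonOpposite g∈ f∈ sg∈ sf∉ (oppositeFlags-sym o)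
    ... | _ | moved _   | _ | moved _   =
      nonOpposite f∈ g∈ (ne ∘ cong (shiftFlag i j)) (oppositeFlags-unshift o)

    shiftIn-isFlag : ∀ {f} → f ∈ 𝓕 → IsFlag n T (shiftIn i j 𝓕 f)
    shiftIn-isFlag {f} f∈ with shiftIn i j 𝓕 f | shiftIn-view f
    ... | _ | kept _  = All.lookup flags f∈
    ... | _ | moved _ = shiftFlag-isFlag (All.lookup flags f∈)

    shiftFamily-unique : Unique (shiftFamily i j 𝓕)
    shiftFamily-unique = unique-map⁺ shiftIn-injectiveOn unique

    shiftFamily-independent : IsIndependent n T (shiftFamily i j 𝓕)
    shiftFamily-independent =
      (shiftFamily-unique , All.map⁺ (All.tabulate shiftIn-isFlag)) , nonOpposite′
      where
      nonOpposite′ : ∀ {f′ g′} → f′ ∈ shiftFamily i j 𝓕 → g′ ∈ shiftFamily i j 𝓕 →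
        f′ ≢ g′ → ¬ OppositeFlags f′ g′
      nonOpposite′ f′∈ g′∈ with ∈-map⁻ (shiftIn i j 𝓕) f′∈ | ∈-map⁻ (shiftIn i j 𝓕) g′∈
      ... | _ , f∈ , refl | _ , g∈ , refl = shiftIn-nonOpposite f∈ g∈

lemma2p11 : (n : ℕ) → 2 ≤ n → (T : List ℕ) → IsType n T →
    (i j : Fin n) → (𝓕 : List (Flag n)) → IsIndependent n T 𝓕 →
    IsIndependent n T (shiftFamily i j 𝓕) ×
    (Unique (shiftFamily i j 𝓕) × length (shiftFamily i j 𝓕) ≡ length 𝓕)
lemma2p11 n _ T _ i j 𝓕 independent =
  shiftFamily-independent independent , shiftFamily-unique independent , length-map _ 𝓕
  where open Shift i j
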